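{- Let $T=(V,E)$ be a tree with $|V|\ge 2$. Then there exists a center edge $e=uv\in E$ such that the cut $\delta(V^e_u)$ is a sparsest cut of $T$, and $$b(T)=\frac12\Big(\frac{1}{|V^e_u|}+\frac{1}{|V^e_v|}\Big).$$
   Context: For an edge $e=uv$ of a tree $T$, removing $e$ leaves two trees; $V^e_u$ is the vertex set of the one containing $u$ and $V^e_v$ that of the one containing $v$. A center edge is an edge $e=uv$ minimizing $\big||V^e_u|-|V^e_v|\big|$ over all edges. For $S\subseteq V$, $\delta(S)$ is the set of edges with exactly one endpoint in $S$; the edge density of the cut is $\rho(S)=|\delta(S)|/(|S|(|V|-|S|))$, and a sparsest cut is a cut $\delta(S)$, $\emptyset\ne S\subsetneq V$, minimizing $\rho(S)$. $b(T)=\min\{\sum_{xy\in E}|z_x-z_y|:\ z\in\mathbb{R}^V,\ \sum_w z_w=0,\ \sum_w|z_w|=1\}$.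
   Formalization: The vectors z in the minimum defining b(T) are taken over ℚ^V instead of ℝ^V. -}

module Defs where

open import Data.Nat as ℕ using (ℕ; zero; suc; _∸_)
open import Data.Fin using (Fin)
open import Data.Fin.Subset using (Subset; _∈_; ∣_∣; Nonempty; ∁)
open import Data.Bool using (Bool; true; false; _xor_)
open import Data.Vec using (lookup)
open import Data.List as L using (List; []; _∷_; length; removeAt; map)
open import Data.List.Membership.Propositional as LM using ()
open import Data.Product using (_×_; _,_; proj₁; proj₂; Σ)
open import Data.Sum using (_⊎_)
open import Data.Integer using (+_)
open import Data.Rational as ℚ using (ℚ; 0ℚ; _/_; _+_; _-_; _≤_)
open import Relation.Nullary using (¬_)
open import Function.Bundles using (_⇔_)

Graph : ℕ → Set
Graph n = List (Fin n × Fin n)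

data Reach {n : ℕ} (E : Graph n) : Fin n → Fin n → Set where
  here : ∀ {x} → Reach E x x
  step : ∀ {x y w} → (LM._∈_ (x , y) E ⊎ LM._∈_ (y , x) E) → Reach E y w → Reach E x w

Connected : ∀ {n} → Graph n → Set
Connected {n} E = ∀ (x y : Fin n) → Reach E x y

-- Acyclic: no edge lies on a cycle, i.e. after deleting any edge its
-- endpoints are no longer connected (this also excludes loops and parallel edges).
Acyclic : ∀ {n} → Graph n → Set
Acyclic E = ∀ (i : Fin (length E)) →
  ¬ Reach (removeAt E i) (proj₁ (L.lookup E i)) (proj₂ (L.lookup E i))

IsTree : ∀ {n} → Graph n → Set
IsTree E = Connected E × Acyclic E

IsComponentOf : ∀ {n} → Graph n → Fin n → Subset n → Set
IsComponentOf {n} E x S = ∀ (y : Fin n) → (y ∈ S) ⇔ Reach E x y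

Sides : ∀ {n} (E : Graph n) → Fin (length E) → Subset n → Subset n → Set
Sides E i Su Sv =
  IsComponentOf (removeAt E i) (proj₁ (L.lookup E i)) Su ×
  IsComponentOf (removeAt E i) (proj₂ (L.lookup E i)) Sv

IsCenterEdge : ∀ {n} (E : Graph n) → Fin (length E) → Set
IsCenterEdge {n} E i =
  ∀ (Su Sv : Subset n) → Sides E i Su Sv →
  ∀ (j : Fin (length E)) (Su' Sv' : Subset n) → Sides E j Su' Sv' →
  ℕ.∣ ∣ Su ∣ - ∣ Sv ∣ ∣ ℕ.≤ ℕ.∣ ∣ Su' ∣ - ∣ Sv' ∣ ∣

cutSize : ∀ {n} → Graph n → Subset n → ℕ
cutSize [] S = 0
cutSize ((x , y) ∷ E) S with lookup S x xor lookup S y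
... | true  = suc (cutSize E S)
... | false = cutSize E S

-- Edge density ρ(S) = |δ(S)| / (|S| (|V| - |S|)); (value 0 when the
-- denominator vanishes, which only happens for S = ∅ or S = V, never used).
density : ∀ {n} → Graph n → Subset n → ℚ
density {n} E S with ∣ S ∣ ℕ.* (n ∸ ∣ S ∣)
... | zero  = 0ℚ
... | suc k = (+ cutSize E S) / suc k

IsSparsestCut : ∀ {n} → Graph n → Subset n → Set
IsSparsestCut {n} E S =
  Nonempty S × Nonempty (∁ S) ×
  (∀ (S' : Subset n) → Nonempty S' → Nonempty (∁ S') → density E S ≤ density E S')

sumℚ : List ℚ → ℚ
sumℚ = L.foldr _+_ 0ℚ

-- the objective and feasibility of the optimisation problem defining b(T)
objective : ∀ {n} → Graph n → (Fin n → ℚ) → ℚ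
objective E z = sumℚ (map (λ e → ℚ.∣ z (proj₁ e) - z (proj₂ e) ∣) E)

Feasible : ∀ {n} → (Fin n → ℚ) → Set
Feasible {n} z = sumℚ (map z (L.allFin n)) ≡ 0ℚ × sumℚ (map (λ w → ℚ.∣ z w ∣) (L.allFin n)) ≡ ℚ.1ℚ
  where open import Relation.Binary.PropositionalEquality using (_≡_)

IsBValue : ∀ {n} → Graph n → ℚ → Set
IsBValue {n} E β =
  Σ (Fin n → ℚ) (λ z → Feasible z × objective E z ≡ β) ×
  (∀ (z : Fin n → ℚ) → Feasible z → β ≤ objective E z)
  where open import Relation.Binary.PropositionalEquality using (_≡_)

-- 1/k as a rational (k ≥ 1 in all uses; 1/0 := 0 is junk)
recip : ℕ → ℚ
recip zero    = 0ℚ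
recip (suc k) = (+ 1) / suc k

{-# OPTIONS --safe #-}
module Submission where

-- Deleting the edge i = u v of the tree splits the vertices into Side i, the component of u, and its
-- complement, the component of v, and edge i is the only edge between them. Hence summation by parts
--   Σ_w d_w z_w = Σ_i (Σ_{w ∈ Side i} d_w) (z_u - z_v)      whenever Σ_w d_w = 0.
-- For d = n 1_P - |P| the inner sum equals |∁ Side i| |P ∩ Side i| - |Side i| |P ∖ Side i|, whose absolute
-- value is at most |Side i| |∁ Side i| ≤ p q, where p + q = n are the side sizes of a center edge (the more
-- balanced split has the larger product). So for all P and z,
--   n Σ_{w ∈ P} z_w - |P| Σ_w z_w ≤ p q Σ_{uv ∈ E} |z_u - z_v|.
-- With z = 1_S and P = S this reads |S| (n - |S|) ≤ p q |δ(S)|: the center cut, of density 1/(pq), is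
-- sparsest. With P = {z ≥ 0} and z feasible it reads n/2 ≤ p q Σ |z_u - z_v|, so b(T) ≥ n/(2pq), which
-- equals ½ (1/p + 1/q) and is attained by the z that is constant on either side of the center edge.

open import Defs
open import Data.Nat using (ℕ)
open import Data.Fin using (Fin)
open import Data.List using (length)

module SubsetFacts where
  open import Data.Nat as ℕ using (NonZero)
  import Data.Nat.Properties as ℕₚ
  open import Data.Fin.Subset using (Subset; _∈_; ∁; ∣_∣; Nonempty)
  open import Data.Fin.Subset.Properties using (∣∁p∣≡n∸∣p∣; ∣p∣≤n; x∈p⇒∣p-x∣<∣p∣)
  open import Data.Product using (_,_)
  open import Data.Vec using (tabulate)
  open import Data.Vec.Properties using (lookup∘tabulate; []=⇒lookup; lookup⇒[]=)
  open import Function using (_∘_)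
  open import Function.Bundles using (_⇔_; mk⇔)
  open import Relation.Nullary using (Dec; yes; no; does)
  open import Relation.Nullary.Decidable using (dec-true)
  open import Relation.Binary.PropositionalEquality

  ∣p∣+∣∁p∣≡n : ∀ {n} (p : Subset n) → ∣ p ∣ ℕ.+ ∣ ∁ p ∣ ≡ n
  ∣p∣+∣∁p∣≡n p = trans (cong (∣ p ∣ ℕ.+_) (∣∁p∣≡n∸∣p∣ p)) (ℕₚ.m+[n∸m]≡n (∣p∣≤n p))

  Nonempty⇒∣p∣≢0 : ∀ {n} {p : Subset n} → Nonempty p → NonZero ∣ p ∣
  Nonempty⇒∣p∣≢0 (x , x∈p) = ℕ.>-nonZero (ℕₚ.≤-<-trans ℕ.z≤n (x∈p⇒∣p-x∣<∣p∣ x∈p))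

  ∈-tabulate-does⇔ : ∀ {n} {P : Fin n → Set} (P? : ∀ w → Dec (P w)) {w} → w ∈ tabulate (does ∘ P?) ⇔ P w
  ∈-tabulate-does⇔ {P = P} P? {w} = mk⇔ to from
    where
    to : w ∈ tabulate (does ∘ P?) → P w
    to w∈ with P? w | trans (sym (lookup∘tabulate (does ∘ P?) w)) ([]=⇒lookup w∈)
    ... | yes p | _ = p
    ... | no _  | ()
    from : P w → w ∈ tabulate (does ∘ P?)
    from p = lookup⇒[]= w _ (trans (lookup∘tabulate (does ∘ P?) w) (dec-true (P? w) p))

module RationalFacts where
  open import Data.Bool using (Bool; true; false; not)
  open import Data.Nat as ℕ using (zero; suc; NonZero)
  import Data.Nat.Properties as ℕₚ
  import Data.Integer as ℤ
  import Data.Integer.Properties as ℤₚ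
  open import Data.Rational as ℚ
    using (ℚ; 0ℚ; 1ℚ; ½; _+_; _*_; _-_; -_; _≤_; _/_; toℚᵘ; Positive; positive; nonNegative)
  import Data.Rational.Properties as ℚₚ
  import Data.Rational.Unnormalised as ℚᵘ
  import Data.Rational.Unnormalised.Properties as ℚᵘ
  open import Data.Rational.Solver using (module +-*-Solver)
  open +-*-Solver
  open import Algebra.Bundles using (Ring)
  import Algebra.Properties.Semiring.Mult (Ring.semiring ℚₚ.+-*-ring) as Mult
  open import Data.Product using (_,_)
  open import Data.Sum using (inj₁; inj₂)
  open import Relation.Nullary using (Dec; does; yes; no; contradiction)
  open import Relation.Binary.PropositionalEquality

  fromℕ : ℕ → ℚ
  fromℕ n = n Mult.× 1ℚ

  fromℕ-+ : ∀ m n → fromℕ (m ℕ.+ n) ≡ fromℕ m + fromℕ n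
  fromℕ-+ = Mult.×-homo-+ 1ℚ

  fromℕ-* : ∀ m n → fromℕ (m ℕ.* n) ≡ fromℕ m * fromℕ n
  fromℕ-* = Mult.×1-homo-*

  0≤fromℕ : ∀ n → 0ℚ ≤ fromℕ n
  0≤fromℕ zero    = ℚₚ.≤-refl
  0≤fromℕ (suc n) = ℚₚ.+-mono-≤ (ℚₚ.nonNegative⁻¹ 1ℚ) (0≤fromℕ n)

  fromℕ-mono-≤ : ∀ {m n} → m ℕ.≤ n → fromℕ m ≤ fromℕ n
  fromℕ-mono-≤ {m} m≤n with ℕₚ.m≤n⇒∃[o]m+o≡n m≤n
  ... | o , refl = begin
    fromℕ m            ≡⟨ ℚₚ.+-identityʳ (fromℕ m) ⟨
    fromℕ m + 0ℚ       ≤⟨ ℚₚ.+-monoʳ-≤ (fromℕ m) (0≤fromℕ o) ⟩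
    fromℕ m + fromℕ o  ≡⟨ fromℕ-+ m o ⟨
    fromℕ (m ℕ.+ o)    ∎
    where open ℚₚ.≤-Reasoning

  fromℕ-pos : ∀ n .{{_ : NonZero n}} → Positive (fromℕ n)
  fromℕ-pos (suc n) = positive (ℚₚ.+-mono-<-≤ (ℚₚ.positive⁻¹ 1ℚ) (0≤fromℕ n))

  private
    toℚᵘ-fromℕ : ∀ n → toℚᵘ (fromℕ n) ℚᵘ.≃ ℚᵘ.mkℚᵘ (ℤ.+ n) 0
    toℚᵘ-fromℕ zero    = ℚᵘ.*≡* refl
    toℚᵘ-fromℕ (suc n) = ℚᵘ.≃-trans (ℚₚ.toℚᵘ-homo-+ 1ℚ (fromℕ n))
      (ℚᵘ.≃-trans (ℚᵘ.+-congʳ (toℚᵘ 1ℚ) (toℚᵘ-fromℕ n)) (ℚᵘ.*≡* (trans (ℤₚ.*-identityʳ _)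
        (trans (cong (ℤ._+_ ℤ.1ℤ) (ℤₚ.*-identityʳ (ℤ.+ n))) (sym (ℤₚ.*-identityʳ _))))))

  /≡*recip : ∀ c k → ℤ.+ c / suc k ≡ fromℕ c * recip (suc k)
  /≡*recip c k = ℚₚ.toℚᵘ-injective (begin
    toℚᵘ (ℤ.+ c / suc k)
      ≈⟨ ℚₚ.toℚᵘ-fromℚᵘ (ℚᵘ.mkℚᵘ (ℤ.+ c) k) ⟩
    ℚᵘ.mkℚᵘ (ℤ.+ c) k
      ≈⟨ ℚᵘ.*≡* cross-multiplied ⟩
    ℚᵘ.mkℚᵘ (ℤ.+ c) 0 ℚᵘ.* ℚᵘ.mkℚᵘ (ℤ.+ 1) k
      ≈⟨ ℚᵘ.*-cong (toℚᵘ-fromℕ c) (ℚₚ.toℚᵘ-fromℚᵘ _) ⟨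
    toℚᵘ (fromℕ c) ℚᵘ.* toℚᵘ (recip (suc k))
      ≈⟨ ℚₚ.toℚᵘ-homo-* (fromℕ c) (recip (suc k)) ⟨
    toℚᵘ (fromℕ c * recip (suc k))
      ∎)
    where
    open ℚᵘ.≃-Reasoning
    cross-multiplied : ℤ.+ c ℤ.* (ℤ.+ 1 ℤ.* ℤ.+ suc k) ≡ (ℤ.+ c ℤ.* ℤ.+ 1) ℤ.* ℤ.+ suc k
    cross-multiplied = trans (cong (ℤ.+ c ℤ.*_) (ℤₚ.*-identityˡ (ℤ.+ suc k)))
                             (cong (ℤ._* ℤ.+ suc k) (sym (ℤₚ.*-identityʳ (ℤ.+ c))))

  fromℕ*recip≡1 : ∀ n .{{_ : NonZero n}} → fromℕ n * recip n ≡ 1ℚ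
  fromℕ*recip≡1 (suc k) = trans (sym (/≡*recip (suc k) k)) (ℚₚ.toℚᵘ-injective
    (ℚᵘ.≃-trans (ℚₚ.toℚᵘ-fromℚᵘ (ℚᵘ.mkℚᵘ (ℤ.+ suc k) k))
                (ℚᵘ.*≡* (ℤₚ.*-comm (ℤ.+ suc k) (ℤ.+ 1)))))

  0≤recip : ∀ n → 0ℚ ≤ recip n
  0≤recip zero    = ℚₚ.≤-refl
  0≤recip (suc n) = ℚₚ.nonNegative⁻¹ _ {{ℚₚ.normalize-nonNeg 1 (suc n)}}

  0≤½*recip : ∀ m → 0ℚ ≤ ½ * recip m
  0≤½*recip m = ℚₚ.nonNegative⁻¹ _ {{ℚₚ.nonNeg*nonNeg⇒nonNeg ½ (recip m) {{nonNegative (0≤recip m)}}}}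

  fromℕ*[½*recip]≡½ : ∀ m .{{_ : NonZero m}} → fromℕ m * (½ * recip m) ≡ ½
  fromℕ*[½*recip]≡½ m = begin
    fromℕ m * (½ * recip m)   ≡⟨ solve 3 (λ a h r → a :* (h :* r) := h :* (a :* r)) refl (fromℕ m) ½ (recip m) ⟩
    ½ * (fromℕ m * recip m)   ≡⟨ cong (½ *_) (fromℕ*recip≡1 m) ⟩
    ½ * 1ℚ                    ≡⟨ ℚₚ.*-identityʳ ½ ⟩
    ½                         ∎
    where open ≡-Reasoning

  *-recip-≤ : ∀ {a b} .{{_ : NonZero a}} .{{_ : NonZero b}} {x y} →
              x * fromℕ b ≤ y * fromℕ a → x * recip a ≤ y * recip b
  *-recip-≤ {a} {b} {x} {y} xb≤ya =
    ℚₚ.*-cancelʳ-≤-pos (A * B) {{ℚₚ.pos*pos⇒pos A {{fromℕ-pos a}} B {{fromℕ-pos b}}}} (begin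
    x * recip a * (A * B)   ≡⟨ solve 4 (λ x r A B → x :* r :* (A :* B) := x :* B :* (A :* r)) refl x (recip a) A B ⟩
    x * B * (A * recip a)   ≡⟨ cong (λ t → x * B * t) (fromℕ*recip≡1 a) ⟩
    x * B * 1ℚ              ≡⟨ ℚₚ.*-identityʳ (x * B) ⟩
    x * B                   ≤⟨ xb≤ya ⟩
    y * A                   ≡⟨ ℚₚ.*-identityʳ (y * A) ⟨
    y * A * 1ℚ              ≡⟨ cong (λ t → y * A * t) (fromℕ*recip≡1 b) ⟨
    y * A * (B * recip b)   ≡⟨ solve 4 (λ y r A B → y :* A :* (B :* r) := y :* r :* (A :* B)) refl y (recip b) A B ⟩
    y * recip b * (A * B)   ∎)
    where
    open ℚₚ.≤-Reasoning
    A B : ℚ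
    A = fromℕ a
    B = fromℕ b

  nonNeg*nonNeg : ∀ {p q} → 0ℚ ≤ p → 0ℚ ≤ q → 0ℚ ≤ p * q
  nonNeg*nonNeg {p} {q} 0≤p 0≤q =
    ℚₚ.nonNegative⁻¹ _ {{ℚₚ.nonNeg*nonNeg⇒nonNeg p {{nonNegative 0≤p}} q {{nonNegative 0≤q}}}}

  p≤∣p∣ : ∀ p → p ≤ ℚ.∣ p ∣
  p≤∣p∣ p with ℚₚ.≤-total 0ℚ p
  ... | inj₁ 0≤p = ℚₚ.≤-reflexive (sym (ℚₚ.0≤p⇒∣p∣≡p 0≤p))
  ... | inj₂ p≤0 = ℚₚ.≤-trans p≤0 (ℚₚ.0≤∣p∣ p)

  ∣p∣≤q : ∀ {p q} → - q ≤ p → p ≤ q → ℚ.∣ p ∣ ≤ q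
  ∣p∣≤q {p} {q} -q≤p p≤q with ℚₚ.∣p∣≡p∨∣p∣≡-p p
  ... | inj₁ ∣p∣≡p  = subst (_≤ q) (sym ∣p∣≡p) p≤q
  ... | inj₂ ∣p∣≡-p =
    subst₂ _≤_ (sym ∣p∣≡-p) (solve 1 (λ q → :- (:- q) := q) refl q) (ℚₚ.neg-antimono-≤ -q≤p)

  ∣x-y∣≤c : ∀ {x y c} → 0ℚ ≤ x → x ≤ c → 0ℚ ≤ y → y ≤ c → ℚ.∣ x - y ∣ ≤ c
  ∣x-y∣≤c {x} {y} {c} 0≤x x≤c 0≤y y≤c = ∣p∣≤q lower upper
    where
    open ℚₚ.≤-Reasoning
    lower : - c ≤ x - y
    lower = begin
      - c       ≤⟨ ℚₚ.neg-antimono-≤ y≤c ⟩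
      - y       ≡⟨ ℚₚ.+-identityˡ (- y) ⟨
      0ℚ - y    ≤⟨ ℚₚ.+-monoˡ-≤ (- y) 0≤x ⟩
      x - y     ∎
    upper : x - y ≤ c
    upper = begin
      x - y     ≤⟨ ℚₚ.+-monoʳ-≤ x (ℚₚ.neg-antimono-≤ 0≤y) ⟩
      x - 0ℚ    ≡⟨ ℚₚ.+-identityʳ x ⟩
      x         ≤⟨ x≤c ⟩
      c         ∎

  ∣q*x-p*y∣≤p*q : ∀ {p q x y} → 0ℚ ≤ x → x ≤ p → 0ℚ ≤ y → y ≤ q →
                  ℚ.∣ q * x - p * y ∣ ≤ p * q
  ∣q*x-p*y∣≤p*q {p} {q} 0≤x x≤p 0≤y y≤q = ∣x-y∣≤c
    (nonNeg*nonNeg 0≤q 0≤x) (subst (_ ≤_) (ℚₚ.*-comm q p) (ℚₚ.*-monoˡ-≤-nonNeg q {{nonNegative 0≤q}} x≤p))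
    (nonNeg*nonNeg 0≤p 0≤y) (ℚₚ.*-monoˡ-≤-nonNeg p {{nonNegative 0≤p}} y≤q)
    where
    0≤p : 0ℚ ≤ p
    0≤p = ℚₚ.≤-trans 0≤x x≤p
    0≤q : 0ℚ ≤ q
    0≤q = ℚₚ.≤-trans 0≤y y≤q

  𝟙 : Bool → ℚ
  𝟙 true  = 1ℚ
  𝟙 false = 0ℚ

  0≤𝟙 : ∀ b → 0ℚ ≤ 𝟙 b
  0≤𝟙 true  = ℚₚ.nonNegative⁻¹ 1ℚ
  0≤𝟙 false = ℚₚ.≤-refl

  𝟙*𝟙≡𝟙 : ∀ b → 𝟙 b * 𝟙 b ≡ 𝟙 b
  𝟙*𝟙≡𝟙 true  = refl
  𝟙*𝟙≡𝟙 false = refl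

  𝟙*𝟙≤𝟙 : ∀ a b → 𝟙 a * 𝟙 b ≤ 𝟙 b
  𝟙*𝟙≤𝟙 true  b = ℚₚ.≤-reflexive (ℚₚ.*-identityˡ (𝟙 b))
  𝟙*𝟙≤𝟙 false b = ℚₚ.≤-trans (ℚₚ.≤-reflexive (ℚₚ.*-zeroˡ (𝟙 b))) (0≤𝟙 b)

  𝟙≡𝟙*𝟙+𝟙*𝟙[not] : ∀ a b → 𝟙 a ≡ 𝟙 a * 𝟙 b + 𝟙 a * 𝟙 (not b)
  𝟙≡𝟙*𝟙+𝟙*𝟙[not] true  true  = refl
  𝟙≡𝟙*𝟙+𝟙*𝟙[not] true  false = refl
  𝟙≡𝟙*𝟙+𝟙*𝟙[not] false true  = refl
  𝟙≡𝟙*𝟙+𝟙*𝟙[not] false false = refl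

  ∣p∣+p≡𝟙[0≤p]*[p+p] : ∀ p (0≤p? : Dec (0ℚ ≤ p)) → ℚ.∣ p ∣ + p ≡ 𝟙 (does 0≤p?) * (p + p)
  ∣p∣+p≡𝟙[0≤p]*[p+p] p 0≤p? with 0≤p? | ℚₚ.∣p∣≡p∨∣p∣≡-p p
  ... | yes 0≤p | _           =
    trans (cong (_+ p) (ℚₚ.0≤p⇒∣p∣≡p 0≤p)) (sym (ℚₚ.*-identityˡ (p + p)))
  ... | no  0≰p | inj₁ ∣p∣≡p  = contradiction (ℚₚ.∣p∣≡p⇒0≤p ∣p∣≡p) 0≰p
  ... | no  _   | inj₂ ∣p∣≡-p =
    trans (cong (_+ p) ∣p∣≡-p) (trans (ℚₚ.+-inverseˡ p) (sym (ℚₚ.*-zeroˡ (p + p))))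

module FiniteSums where
  open RationalFacts
  open SubsetFacts using (∣p∣+∣∁p∣≡n)
  open import Data.Bool using (Bool; true; false; not)
  open import Data.Nat as ℕ using (zero; suc)
  open import Data.Fin using (zero; suc; punchIn)
  open import Data.Fin.Properties using (punchInᵢ≢i)
  open import Data.Fin.Subset using (Subset; ∁; ∣_∣)
  open import Data.List as List using (List; []; _∷_; allFin)
  import Data.List.Properties as List
  open import Data.Rational as ℚ using (ℚ; 0ℚ; 1ℚ; ½; _+_; _*_; _-_; -_; _≤_)
  import Data.Rational.Properties as ℚₚ
  open import Data.Rational.Solver using (module +-*-Solver)
  open +-*-Solver
  open import Algebra.Bundles using (Ring)
  import Algebra.Properties.Semiring.Mult (Ring.semiring ℚₚ.+-*-ring) as Mult
  open import Algebra.Properties.Semiring.Sum (Ring.semiring ℚₚ.+-*-ring) public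
    using (sum; sum-syntax; sum-cong-≗; ∑-distrib-+; ∑-comm; *-distribˡ-sum; *-distribʳ-sum)
  open import Algebra.Properties.Semiring.Sum (Ring.semiring ℚₚ.+-*-ring)
    using (sum-remove; sum-replicate; sum-replicate-zero)
  open import Data.Vec using ([]; _∷_) renaming (lookup to _!_)
  open import Data.Vec.Properties using (lookup-map)
  open import Function using (_∘_; id)
  open import Relation.Nullary using (Dec; does)
  open import Relation.Binary.PropositionalEquality

  ∑-neg : ∀ {n} (f : Fin n → ℚ) → (∑[ i < n ] (- f i)) ≡ - sum f
  ∑-neg {zero}  f = refl
  ∑-neg {suc n} f = trans (cong (- f zero +_) (∑-neg (f ∘ suc))) (sym (ℚₚ.neg-distrib-+ (f zero) _))

  ∑-distrib-minus : ∀ {n} (f g : Fin n → ℚ) → (∑[ i < n ] (f i - g i)) ≡ sum f - sum g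
  ∑-distrib-minus f g = trans (∑-distrib-+ f (λ i → - g i)) (cong (sum f +_) (∑-neg g))

  ∑-mono-≤ : ∀ {n} {f g : Fin n → ℚ} → (∀ i → f i ≤ g i) → sum f ≤ sum g
  ∑-mono-≤ {zero}  f≤g = ℚₚ.≤-refl
  ∑-mono-≤ {suc n} f≤g = ℚₚ.+-mono-≤ (f≤g zero) (∑-mono-≤ (f≤g ∘ suc))

  ∑-nonNeg : ∀ {n} {f : Fin n → ℚ} → (∀ i → 0ℚ ≤ f i) → 0ℚ ≤ sum f
  ∑-nonNeg {n} {f} 0≤f = subst (_≤ sum f) (sum-replicate-zero n) (∑-mono-≤ {f = λ _ → 0ℚ} 0≤f)

  ∑-const : ∀ n c → (∑[ i < n ] c) ≡ fromℕ n * c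
  ∑-const n c = begin
    (∑[ i < n ] c)      ≡⟨ sum-replicate n ⟩
    n Mult.× c          ≡⟨ cong (n Mult.×_) (ℚₚ.*-identityˡ c) ⟨
    n Mult.× (1ℚ * c)   ≡⟨ Mult.×-assoc-* n 1ℚ c ⟨
    fromℕ n * c         ∎
    where open ≡-Reasoning

  ∑-only : ∀ {n} (f : Fin n → ℚ) j → (∀ i → i ≢ j → f i ≡ 0ℚ) → sum f ≡ f j
  ∑-only {suc n} f j others≡0 = begin
    sum f
      ≡⟨ sum-remove f ⟩
    f j + (∑[ k < n ] f (punchIn j k))
      ≡⟨ cong (f j +_) (sum-cong-≗ (λ k → others≡0 (punchIn j k) (punchInᵢ≢i j k))) ⟩
    f j + (∑[ k < n ] 0ℚ)                ≡⟨ cong (f j +_) (sum-replicate-zero n) ⟩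
    f j + 0ℚ                             ≡⟨ ℚₚ.+-identityʳ (f j) ⟩
    f j                                  ∎
    where open ≡-Reasoning

  ∑-*-constant≡0 : ∀ {n} (d h : Fin n → ℚ) → (∀ x y → h x ≡ h y) → sum d ≡ 0ℚ →
                   (∑[ w < n ] (d w * h w)) ≡ 0ℚ
  ∑-*-constant≡0 {zero}  d h _        _    = refl
  ∑-*-constant≡0 {suc n} d h constant ∑d≡0 = begin
    (∑[ w < suc n ] (d w * h w))      ≡⟨ sum-cong-≗ (λ w → cong (d w *_) (constant w zero)) ⟩
    (∑[ w < suc n ] (d w * h zero))   ≡⟨ *-distribʳ-sum (h zero) d ⟨
    sum d * h zero                    ≡⟨ cong (_* h zero) ∑d≡0 ⟩
    0ℚ * h zero                       ≡⟨ ℚₚ.*-zeroˡ (h zero) ⟩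
    0ℚ                                ∎
    where open ≡-Reasoning

  sumℚ-map : ∀ {A : Set} (xs : List A) (h : A → ℚ) →
             sumℚ (List.map h xs) ≡ (∑[ i < List.length xs ] h (List.lookup xs i))
  sumℚ-map []       h = refl
  sumℚ-map (x ∷ xs) h = cong (h x +_) (sumℚ-map xs h)

  sumℚ-allFin : ∀ {n} (f : Fin n → ℚ) → sumℚ (List.map f (allFin n)) ≡ sum f
  sumℚ-allFin f = trans (cong sumℚ (List.map-tabulate id f)) (sumℚ-tabulate f)
    where
    sumℚ-tabulate : ∀ {n} (f : Fin n → ℚ) → sumℚ (List.tabulate f) ≡ sum f
    sumℚ-tabulate {zero}  f = refl
    sumℚ-tabulate {suc n} f = cong (f zero +_) (sumℚ-tabulate (f ∘ suc))

  ∑-𝟙 : ∀ {n} (S : Subset n) → (∑[ w < n ] 𝟙 (S ! w)) ≡ fromℕ ∣ S ∣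
  ∑-𝟙 []          = refl
  ∑-𝟙 (true ∷ S)  = cong (1ℚ +_) (∑-𝟙 S)
  ∑-𝟙 (false ∷ S) = trans (ℚₚ.+-identityˡ _) (∑-𝟙 S)

  ∑-∘lookup : ∀ {n} (φ : Bool → ℚ) (S : Subset n) →
              (∑[ w < n ] φ (S ! w)) ≡ fromℕ ∣ S ∣ * φ true + fromℕ ∣ ∁ S ∣ * φ false
  ∑-∘lookup φ []          = solve 2 (λ a b → con 0ℚ := con 0ℚ :* a :+ con 0ℚ :* b) refl (φ true) (φ false)
  ∑-∘lookup φ (true ∷ S)  = trans (cong (φ true +_) (∑-∘lookup φ S))
    (solve 4 (λ s c a b → a :+ (s :* a :+ c :* b) := (con 1ℚ :+ s) :* a :+ c :* b) refl
             (fromℕ ∣ S ∣) (fromℕ ∣ ∁ S ∣) (φ true) (φ false))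
  ∑-∘lookup φ (false ∷ S) = trans (cong (φ false +_) (∑-∘lookup φ S))
    (solve 4 (λ s c a b → b :+ (s :* a :+ c :* b) := s :* a :+ (con 1ℚ :+ c) :* b) refl
             (fromℕ ∣ S ∣) (fromℕ ∣ ∁ S ∣) (φ true) (φ false))

  fromℕ[n]≡∣p∣+∣∁p∣ : ∀ {n} (p : Subset n) → fromℕ n ≡ fromℕ ∣ p ∣ + fromℕ ∣ ∁ p ∣
  fromℕ[n]≡∣p∣+∣∁p∣ p = trans (cong fromℕ (sym (∣p∣+∣∁p∣≡n p))) (fromℕ-+ ∣ p ∣ ∣ ∁ p ∣)

  ∑-𝟙-split : ∀ {n} (P A : Subset n) →
    (∑[ w < n ] 𝟙 (P ! w)) ≡ (∑[ w < n ] (𝟙 (P ! w) * 𝟙 (A ! w))) + (∑[ w < n ] (𝟙 (P ! w) * 𝟙 (∁ A ! w)))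
  ∑-𝟙-split P A = trans (sum-cong-≗ split)
    (∑-distrib-+ (λ w → 𝟙 (P ! w) * 𝟙 (A ! w)) (λ w → 𝟙 (P ! w) * 𝟙 (∁ A ! w)))
    where
    split : ∀ w → 𝟙 (P ! w) ≡ 𝟙 (P ! w) * 𝟙 (A ! w) + 𝟙 (P ! w) * 𝟙 (∁ A ! w)
    split w = trans (𝟙≡𝟙*𝟙+𝟙*𝟙[not] (P ! w) (A ! w))
      (cong (λ b → 𝟙 (P ! w) * 𝟙 (A ! w) + 𝟙 (P ! w) * 𝟙 b) (sym (lookup-map w not A)))

  centered : ∀ {n} → Subset n → Fin n → ℚ
  centered {n} P w = fromℕ n * 𝟙 (P ! w) - fromℕ ∣ P ∣

  ∑-centered : ∀ {n} (P : Subset n) → sum (centered P) ≡ 0ℚ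
  ∑-centered {n} P = begin
    (∑[ w < n ] (N * 𝟙 (P ! w) - π))
      ≡⟨ ∑-distrib-minus (λ w → N * 𝟙 (P ! w)) (λ _ → π) ⟩
    (∑[ w < n ] (N * 𝟙 (P ! w))) - (∑[ w < n ] π)
      ≡⟨ cong₂ _-_ (*-distribˡ-sum N (λ w → 𝟙 (P ! w))) (sym (∑-const n π)) ⟨
    N * (∑[ w < n ] 𝟙 (P ! w)) - N * π
      ≡⟨ cong (λ t → N * t - N * π) (∑-𝟙 P) ⟩
    N * π - N * π
      ≡⟨ ℚₚ.+-inverseʳ (N * π) ⟩
    0ℚ
      ∎
    where
    open ≡-Reasoning
    N π : ℚ
    N = fromℕ n
    π = fromℕ ∣ P ∣

  ∑-centered*z : ∀ {n} (P : Subset n) (z : Fin n → ℚ) →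
    (∑[ w < n ] (centered P w * z w)) ≡ fromℕ n * (∑[ w < n ] (𝟙 (P ! w) * z w)) - fromℕ ∣ P ∣ * sum z
  ∑-centered*z {n} P z = begin
    (∑[ w < n ] (centered P w * z w))
      ≡⟨ sum-cong-≗ (λ w → solve 4 (λ N b π x → (N :* b :- π) :* x := N :* (b :* x) :- π :* x) refl
                                   (fromℕ n) (𝟙 (P ! w)) (fromℕ ∣ P ∣) (z w)) ⟩
    (∑[ w < n ] (fromℕ n * (𝟙 (P ! w) * z w) - fromℕ ∣ P ∣ * z w))
      ≡⟨ ∑-distrib-minus (λ w → fromℕ n * (𝟙 (P ! w) * z w)) (λ w → fromℕ ∣ P ∣ * z w) ⟩
    (∑[ w < n ] (fromℕ n * (𝟙 (P ! w) * z w))) - (∑[ w < n ] (fromℕ ∣ P ∣ * z w))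
      ≡⟨ cong₂ _-_ (*-distribˡ-sum (fromℕ n) (λ w → 𝟙 (P ! w) * z w)) (*-distribˡ-sum (fromℕ ∣ P ∣) z) ⟨
    fromℕ n * (∑[ w < n ] (𝟙 (P ! w) * z w)) - fromℕ ∣ P ∣ * sum z
      ∎
    where open ≡-Reasoning

  ∑-centered*𝟙≡∣P∣*∣∁P∣ : ∀ {n} (P : Subset n) →
                         (∑[ w < n ] (centered P w * 𝟙 (P ! w))) ≡ fromℕ (∣ P ∣ ℕ.* ∣ ∁ P ∣)
  ∑-centered*𝟙≡∣P∣*∣∁P∣ {n} P = begin
    (∑[ w < n ] (centered P w * 𝟙 (P ! w)))
      ≡⟨ ∑-centered*z P (λ w → 𝟙 (P ! w)) ⟩
    fromℕ n * (∑[ w < n ] (𝟙 (P ! w) * 𝟙 (P ! w))) - π * (∑[ w < n ] 𝟙 (P ! w))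
      ≡⟨ cong₂ (λ s t → fromℕ n * s - π * t)
               (trans (sum-cong-≗ (λ w → 𝟙*𝟙≡𝟙 (P ! w))) (∑-𝟙 P)) (∑-𝟙 P) ⟩
    fromℕ n * π - π * π
      ≡⟨ cong (λ N → N * π - π * π) (fromℕ[n]≡∣p∣+∣∁p∣ P) ⟩
    (π + π′) * π - π * π
      ≡⟨ solve 2 (λ a b → (a :+ b) :* a :- a :* a := a :* b) refl π π′ ⟩
    π * π′
      ≡⟨ fromℕ-* ∣ P ∣ ∣ ∁ P ∣ ⟨
    fromℕ (∣ P ∣ ℕ.* ∣ ∁ P ∣)
      ∎
    where
    open ≡-Reasoning
    π π′ : ℚ
    π  = fromℕ ∣ P ∣
    π′ = fromℕ ∣ ∁ P ∣

  ∣∑centered*𝟙∣≤∣A∣*∣∁A∣ : ∀ {n} (P A : Subset n) →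
    ℚ.∣ (∑[ w < n ] (centered P w * 𝟙 (A ! w))) ∣ ≤ fromℕ ∣ A ∣ * fromℕ ∣ ∁ A ∣
  ∣∑centered*𝟙∣≤∣A∣*∣∁A∣ {n} P A = subst (λ t → ℚ.∣ t ∣ ≤ α * β) (sym ∑≡βK-αM)
    (∣q*x-p*y∣≤p*q (∑-nonNeg (λ w → nonNeg*nonNeg (0≤𝟙 (P ! w)) (0≤𝟙 (A ! w)))) K≤α
                   (∑-nonNeg (λ w → nonNeg*nonNeg (0≤𝟙 (P ! w)) (0≤𝟙 (∁ A ! w)))) M≤β)
    where
    open ≡-Reasoning
    α β K M : ℚ
    α = fromℕ ∣ A ∣
    β = fromℕ ∣ ∁ A ∣
    K = ∑[ w < n ] (𝟙 (P ! w) * 𝟙 (A ! w))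
    M = ∑[ w < n ] (𝟙 (P ! w) * 𝟙 (∁ A ! w))

    K≤α : K ≤ α
    K≤α = subst (K ≤_) (∑-𝟙 A) (∑-mono-≤ (λ w → 𝟙*𝟙≤𝟙 (P ! w) (A ! w)))

    M≤β : M ≤ β
    M≤β = subst (M ≤_) (∑-𝟙 (∁ A)) (∑-mono-≤ (λ w → 𝟙*𝟙≤𝟙 (P ! w) (∁ A ! w)))

    ∑≡βK-αM : (∑[ w < n ] (centered P w * 𝟙 (A ! w))) ≡ β * K - α * M
    ∑≡βK-αM = begin
      (∑[ w < n ] (centered P w * 𝟙 (A ! w)))
        ≡⟨ ∑-centered*z P (λ w → 𝟙 (A ! w)) ⟩
      fromℕ n * K - fromℕ ∣ P ∣ * (∑[ w < n ] 𝟙 (A ! w))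
        ≡⟨ cong₂ (λ N t → N * K - t) (fromℕ[n]≡∣p∣+∣∁p∣ A)
                 (cong₂ _*_ (trans (sym (∑-𝟙 P)) (∑-𝟙-split P A)) (∑-𝟙 A)) ⟩
      (α + β) * K - (K + M) * α
        ≡⟨ solve 4 (λ a b k m → (a :+ b) :* k :- (k :+ m) :* a := b :* k :- a :* m) refl α β K M ⟩
      β * K - α * M
        ∎

  ∑-𝟙[0≤z]*z≡½ : ∀ {n} (z : Fin n → ℚ) (0≤z? : ∀ w → Dec (0ℚ ≤ z w)) →
    sum z ≡ 0ℚ → (∑[ w < n ] ℚ.∣ z w ∣) ≡ 1ℚ → (∑[ w < n ] (𝟙 (does (0≤z? w)) * z w)) ≡ ½
  ∑-𝟙[0≤z]*z≡½ {n} z 0≤z? ∑z≡0 ∑∣z∣≡1 = begin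
    X              ≡⟨ solve 1 (λ x → x := con ½ :* (x :+ x)) refl X ⟩
    ½ * (X + X)    ≡⟨ cong (½ *_) X+X≡1 ⟩
    ½ * 1ℚ         ≡⟨ ℚₚ.*-identityʳ ½ ⟩
    ½              ∎
    where
    open ≡-Reasoning
    z⁺ : Fin n → ℚ
    z⁺ w = 𝟙 (does (0≤z? w)) * z w
    X : ℚ
    X = sum z⁺
    X+X≡1 : X + X ≡ 1ℚ
    X+X≡1 = begin
      X + X
        ≡⟨ ∑-distrib-+ z⁺ z⁺ ⟨
      (∑[ w < n ] (z⁺ w + z⁺ w))
        ≡⟨ sum-cong-≗ (λ w → trans (sym (ℚₚ.*-distribˡ-+ (𝟙 (does (0≤z? w))) (z w) (z w)))
                                   (sym (∣p∣+p≡𝟙[0≤p]*[p+p] (z w) (0≤z? w)))) ⟩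
      (∑[ w < n ] (ℚ.∣ z w ∣ + z w))    ≡⟨ ∑-distrib-+ (λ w → ℚ.∣ z w ∣) z ⟩
      (∑[ w < n ] ℚ.∣ z w ∣) + sum z    ≡⟨ cong₂ _+_ ∑∣z∣≡1 ∑z≡0 ⟩
      1ℚ + 0ℚ                           ≡⟨ ℚₚ.+-identityʳ 1ℚ ⟩
      1ℚ                                ∎

module NatProducts where
  open import Data.Nat using (_+_; _*_; _≤_; ∣_-_∣)
  open import Data.Nat.Properties
  open import Data.Nat.Solver using (module +-*-Solver)
  open +-*-Solver
  open import Data.Product using (_,_)
  open import Data.Sum using (inj₁; inj₂)
  open import Relation.Binary.PropositionalEquality

  private
    ∣m-n∣²+4mn≡[m+n]²-≤ : ∀ {m n} → m ≤ n → ∣ m - n ∣ * ∣ m - n ∣ + 4 * (m * n) ≡ (m + n) * (m + n)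
    ∣m-n∣²+4mn≡[m+n]²-≤ {m} m≤n with m≤n⇒∃[o]m+o≡n m≤n
    ... | o , refl rewrite ∣m-m+n∣≡n m o =
      solve 2 (λ m o → o :* o :+ con 4 :* (m :* (m :+ o)) := (m :+ (m :+ o)) :* (m :+ (m :+ o))) refl m o

  ∣m-n∣²+4mn≡[m+n]² : ∀ m n → ∣ m - n ∣ * ∣ m - n ∣ + 4 * (m * n) ≡ (m + n) * (m + n)
  ∣m-n∣²+4mn≡[m+n]² m n with ≤-total m n
  ... | inj₁ m≤n = ∣m-n∣²+4mn≡[m+n]²-≤ m≤n
  ... | inj₂ n≤m = begin
    ∣ m - n ∣ * ∣ m - n ∣ + 4 * (m * n)  ≡⟨ cong₂ (λ d p → d * d + 4 * p) (∣-∣-comm m n) (*-comm m n) ⟩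
    ∣ n - m ∣ * ∣ n - m ∣ + 4 * (n * m)  ≡⟨ ∣m-n∣²+4mn≡[m+n]²-≤ n≤m ⟩
    (n + m) * (n + m)                    ≡⟨ cong (λ s → s * s) (+-comm n m) ⟩
    (m + n) * (m + n)                    ∎
    where open ≡-Reasoning

  more-balanced⇒*-≤ : ∀ {a b c d} → a + b ≡ c + d → ∣ c - d ∣ ≤ ∣ a - b ∣ → a * b ≤ c * d
  more-balanced⇒*-≤ {a} {b} {c} {d} a+b≡c+d cd≤ab =
    *-cancelˡ-≤ 4 (+-cancelʳ-≤ (D * D) (4 * (a * b)) (4 * (c * d)) (begin
      4 * (a * b) + D * D    ≡⟨ +-comm (4 * (a * b)) (D * D) ⟩
      D * D + 4 * (a * b)    ≡⟨ ∣m-n∣²+4mn≡[m+n]² a b ⟩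
      (a + b) * (a + b)      ≡⟨ cong (λ s → s * s) a+b≡c+d ⟩
      (c + d) * (c + d)      ≡⟨ ∣m-n∣²+4mn≡[m+n]² c d ⟨
      D′ * D′ + 4 * (c * d)  ≡⟨ +-comm (D′ * D′) (4 * (c * d)) ⟩
      4 * (c * d) + D′ * D′  ≤⟨ +-monoʳ-≤ (4 * (c * d)) (*-mono-≤ cd≤ab cd≤ab) ⟩
      4 * (c * d) + D * D    ∎))
    where
    open ≤-Reasoning
    D D′ : ℕ
    D  = ∣ a - b ∣
    D′ = ∣ c - d ∣

module Reachability where
  open import Data.Fin using (zero; suc; _≟_)
  open import Data.Fin.Subset using (Subset)
  open import Data.Fin.Subset.Properties using (⊆-antisym)
  open import Data.List using (List; []; _∷_; lookup; removeAt)
  open import Data.List.Relation.Unary.Any using (here; there; index)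
  open import Data.List.Relation.Unary.Any.Properties using (lookup-index)
  open import Data.List.Membership.Propositional using (_∈_)
  open import Data.List.Membership.Propositional.Properties using (∈-lookup)
  open import Data.Product using (_×_; _,_; proj₁; proj₂)
  open import Data.Sum using (_⊎_; inj₁; inj₂; [_,_]′)
  open import Function using (_∘′_)
  open import Function.Bundles using (module Equivalence)
  open import Relation.Nullary using (Dec; yes; no; contradiction)
  open import Relation.Nullary.Decidable using (map′; _⊎-dec_; _×-dec_)
  open import Relation.Binary.PropositionalEquality

  open Equivalence using (to; from)

  private
    variable
      A : Set

  ∈-removeAt⁻ : ∀ (xs : List A) i {x} → x ∈ xs → x ≡ lookup xs i ⊎ x ∈ removeAt xs i
  ∈-removeAt⁻ (_ ∷ _)  zero    (here p)  = inj₁ p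
  ∈-removeAt⁻ (_ ∷ _)  zero    (there m) = inj₂ m
  ∈-removeAt⁻ (_ ∷ _)  (suc i) (here p)  = inj₂ (here p)
  ∈-removeAt⁻ (_ ∷ xs) (suc i) (there m) with ∈-removeAt⁻ xs i m
  ... | inj₁ p  = inj₁ p
  ... | inj₂ m′ = inj₂ (there m′)

  lookup∈removeAt : ∀ (xs : List A) {i j} → j ≢ i → lookup xs j ∈ removeAt xs i
  lookup∈removeAt (_ ∷ _)  {zero}  {zero}  j≢i = contradiction refl j≢i
  lookup∈removeAt (_ ∷ _)  {suc i} {zero}  j≢i = here refl
  lookup∈removeAt (_ ∷ xs) {zero}  {suc j} j≢i = ∈-lookup j
  lookup∈removeAt (_ ∷ xs) {suc i} {suc j} j≢i = there (lookup∈removeAt xs (j≢i ∘′ cong suc))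

  module _ {n : ℕ} where

    Reach-mono : ∀ {E F : Graph n} → (∀ {e} → e ∈ E → e ∈ F) → ∀ {x y} → Reach E x y → Reach F x y
    Reach-mono E⊆F here              = here
    Reach-mono E⊆F (step (inj₁ m) r) = step (inj₁ (E⊆F m)) (Reach-mono E⊆F r)
    Reach-mono E⊆F (step (inj₂ m) r) = step (inj₂ (E⊆F m)) (Reach-mono E⊆F r)

    Reach-trans : ∀ {E : Graph n} {x y w} → Reach E x y → Reach E y w → Reach E x w
    Reach-trans here       r′ = r′
    Reach-trans (step m r) r′ = step m (Reach-trans r r′)

    Reach-sym : ∀ {E : Graph n} {x y} → Reach E x y → Reach E y x
    Reach-sym here              = here
    Reach-sym (step (inj₁ m) r) = Reach-trans (Reach-sym r) (step (inj₂ m) here)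
    Reach-sym (step (inj₂ m) r) = Reach-trans (Reach-sym r) (step (inj₁ m) here)

    Reach-[] : ∀ {x y} → Reach {n} [] x y → x ≡ y
    Reach-[] here               = refl
    Reach-[] (step (inj₁ ()) _)
    Reach-[] (step (inj₂ ()) _)

    Reach-removeAt : ∀ (E : Graph n) i {x y} → Reach E x y → Reach (lookup E i ∷ removeAt E i) x y
    Reach-removeAt E i = Reach-mono λ m → [ here , there ]′ (∈-removeAt⁻ E i m)

    Reach-invariant : ∀ {B : Set} {E : Graph n} (f : Fin n → B) →
      (∀ j → f (proj₁ (lookup E j)) ≡ f (proj₂ (lookup E j))) →
      ∀ {x y} → Reach E x y → f x ≡ f y
    Reach-invariant {E = E} f invariant = go
      where
      along : ∀ {x y} → (x , y) ∈ E → f x ≡ f y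
      along m with lookup E (index m) | lookup-index m | invariant (index m)
      ... | _ | refl | fx≡fy = fx≡fy

      go : ∀ {x y} → Reach E x y → f x ≡ f y
      go here              = refl
      go (step (inj₁ m) r) = trans (along m) (go r)
      go (step (inj₂ m) r) = trans (sym (along m)) (go r)

    ReachVia : Fin n × Fin n → Graph n → Fin n → Fin n → Set
    ReachVia (a , b) E x y = Reach E x y ⊎ (Reach E x a × Reach E b y) ⊎ (Reach E x b × Reach E a y)

    ReachVia-prepend : ∀ {e} {E : Graph n} {x x′ y} → Reach E x x′ → ReachVia e E x′ y → ReachVia e E x y
    ReachVia-prepend p (inj₁ r)                = inj₁ (Reach-trans p r)
    ReachVia-prepend p (inj₂ (inj₁ (r₁ , r₂))) = inj₂ (inj₁ (Reach-trans p r₁ , r₂))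
    ReachVia-prepend p (inj₂ (inj₂ (r₁ , r₂))) = inj₂ (inj₂ (Reach-trans p r₁ , r₂))

    ReachVia-cross : ∀ {a b} {E : Graph n} {y} → ReachVia (a , b) E b y → ReachVia (a , b) E a y
    ReachVia-cross (inj₁ r)              = inj₂ (inj₁ (here , r))
    ReachVia-cross (inj₂ (inj₁ (_ , r))) = inj₂ (inj₁ (here , r))
    ReachVia-cross (inj₂ (inj₂ (_ , r))) = inj₁ r

    ReachVia-cross⁻ : ∀ {a b} {E : Graph n} {y} → ReachVia (a , b) E a y → ReachVia (a , b) E b y
    ReachVia-cross⁻ (inj₁ r)              = inj₂ (inj₂ (here , r))
    ReachVia-cross⁻ (inj₂ (inj₁ (_ , r))) = inj₁ r
    ReachVia-cross⁻ (inj₂ (inj₂ (_ , r))) = inj₂ (inj₂ (here , r))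

    Reach-∷⁻ : ∀ {a b} {E : Graph n} {x y} → Reach ((a , b) ∷ E) x y → ReachVia (a , b) E x y
    Reach-∷⁻ here                        = inj₁ here
    Reach-∷⁻ (step (inj₁ (here refl)) r) = ReachVia-cross (Reach-∷⁻ r)
    Reach-∷⁻ (step (inj₂ (here refl)) r) = ReachVia-cross⁻ (Reach-∷⁻ r)
    Reach-∷⁻ (step (inj₁ (there m)) r)   = ReachVia-prepend (step (inj₁ m) here) (Reach-∷⁻ r)
    Reach-∷⁻ (step (inj₂ (there m)) r)   = ReachVia-prepend (step (inj₂ m) here) (Reach-∷⁻ r)

    Reach-∷⁺ : ∀ {a b} {E : Graph n} {x y} → ReachVia (a , b) E x y → Reach ((a , b) ∷ E) x y
    Reach-∷⁺ (inj₁ r)                = Reach-mono there r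
    Reach-∷⁺ (inj₂ (inj₁ (r₁ , r₂))) =
      Reach-trans (Reach-mono there r₁) (step (inj₁ (here refl)) (Reach-mono there r₂))
    Reach-∷⁺ (inj₂ (inj₂ (r₁ , r₂))) =
      Reach-trans (Reach-mono there r₁) (step (inj₂ (here refl)) (Reach-mono there r₂))

    reach? : ∀ (E : Graph n) x y → Dec (Reach E x y)
    reach? [] x y with x ≟ y
    ... | yes refl = yes here
    ... | no x≢y   = no (x≢y ∘′ Reach-[])
    reach? ((a , b) ∷ E) x y = map′ Reach-∷⁺ Reach-∷⁻
      (reach? E x y ⊎-dec ((reach? E x a ×-dec reach? E b y) ⊎-dec (reach? E x b ×-dec reach? E a y)))

    IsComponentOf-unique : ∀ {G : Graph n} {x} {S S′ : Subset n} →
                           IsComponentOf G x S → IsComponentOf G x S′ → S ≡ S′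
    IsComponentOf-unique S-comp S′-comp = ⊆-antisym
      (λ {y} y∈S  → from (S′-comp y) (to (S-comp y) y∈S))
      (λ {y} y∈S′ → from (S-comp y) (to (S′-comp y) y∈S′))

module FundamentalCuts {n : ℕ} (E : Graph n) (tree : IsTree E) where
  open Reachability
  open SubsetFacts using (∈-tabulate-does⇔)
  open import Data.Bool using (true; false)
  open import Data.Nat as ℕ using ()
  open import Data.Fin.Subset using (Subset; _∈_; ∁; ∣_∣)
  open import Data.Fin.Subset.Properties using (x∈∁p⇒x∉p; x∉p⇒x∈∁p)
  open import Data.List using (allFin; lookup; removeAt)
  open import Data.List.Extrema.Nat using (argmin; f[argmin]≤f[xs])
  open import Data.List.Membership.Propositional.Properties using (∈-allFin)
  import Data.List.Relation.Unary.All as All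
  open import Data.Product using (Σ; _×_; _,_; proj₁; proj₂)
  open import Data.Sum using (inj₁; inj₂)
  open import Data.Vec using (tabulate) renaming (lookup to _!_)
  open import Data.Vec.Properties using (lookup∘tabulate)
  open import Function using (_∘_)
  open import Function.Bundles using (_⇔_; mk⇔; module Equivalence)
  open import Relation.Nullary using (¬_; Dec; does; contradiction)
  open import Relation.Nullary.Decidable using (dec-true; dec-false; does-⇔)
  open import Relation.Binary.PropositionalEquality

  open Equivalence using (to; from)

  private
    connected : Connected E
    connected = proj₁ tree
    acyclic : Acyclic E
    acyclic = proj₂ tree

  u v : Fin (length E) → Fin n
  u i = proj₁ (lookup E i)
  v i = proj₂ (lookup E i)

  side? : ∀ i w → Dec (Reach (removeAt E i) (u i) w)
  side? i = reach? (removeAt E i) (u i)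

  Side : Fin (length E) → Subset n
  Side i = tabulate (does ∘ side? i)

  Side-component : ∀ i → IsComponentOf (removeAt E i) (u i) (Side i)
  Side-component i y = ∈-tabulate-does⇔ (side? i)

  reach-v⇔¬reach-u : ∀ i {y} → Reach (removeAt E i) (v i) y ⇔ (¬ Reach (removeAt E i) (u i) y)
  reach-v⇔¬reach-u i {y} = mk⇔
    (λ rv ru → acyclic i (Reach-trans ru (Reach-sym rv)))
    (λ ¬ru → via-edge ¬ru (Reach-∷⁻ (Reach-removeAt E i (connected (u i) y))))
    where
    via-edge : ¬ Reach (removeAt E i) (u i) y → ReachVia (lookup E i) (removeAt E i) (u i) y →
               Reach (removeAt E i) (v i) y
    via-edge ¬ru (inj₁ ru)               = contradiction ru ¬ru
    via-edge _   (inj₂ (inj₁ (_ , rv)))  = rv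
    via-edge _   (inj₂ (inj₂ (ruv , _))) = contradiction ruv (acyclic i)

  ∁Side-component : ∀ i → IsComponentOf (removeAt E i) (v i) (∁ (Side i))
  ∁Side-component i y = mk⇔
    (λ y∈∁ → from (reach-v⇔¬reach-u i) (x∈∁p⇒x∉p y∈∁ ∘ from (Side-component i y)))
    (λ rv → x∉p⇒x∈∁p (to (reach-v⇔¬reach-u i) rv ∘ to (Side-component i y)))

  Side-sides : ∀ i → Sides E i (Side i) (∁ (Side i))
  Side-sides i = Side-component i , ∁Side-component i

  Sides-unique : ∀ i {Su Sv} → Sides E i Su Sv → Su ≡ Side i × Sv ≡ ∁ (Side i)
  Sides-unique i (Su-comp , Sv-comp) =
    IsComponentOf-unique Su-comp (Side-component i) , IsComponentOf-unique Sv-comp (∁Side-component i)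

  u∈Side : ∀ i → u i ∈ Side i
  u∈Side i = from (Side-component i (u i)) here

  v∈∁Side : ∀ i → v i ∈ ∁ (Side i)
  v∈∁Side i = from (∁Side-component i (v i)) here

  Side-u : ∀ i → Side i ! u i ≡ true
  Side-u i = trans (lookup∘tabulate (does ∘ side? i) (u i)) (dec-true (side? i (u i)) here)

  Side-v : ∀ i → Side i ! v i ≡ false
  Side-v i = trans (lookup∘tabulate (does ∘ side? i) (v i)) (dec-false (side? i (v i)) (acyclic i))

  Side-uncut : ∀ i j → j ≢ i → Side i ! u j ≡ Side i ! v j
  Side-uncut i j j≢i = begin
    Side i ! u j          ≡⟨ lookup∘tabulate (does ∘ side? i) (u j) ⟩
    does (side? i (u j))  ≡⟨ does-⇔ (mk⇔ (λ r → Reach-trans r edge) (λ r → Reach-trans r (Reach-sym edge)))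
                                    (side? i (u j)) (side? i (v j)) ⟩
    does (side? i (v j))  ≡⟨ lookup∘tabulate (does ∘ side? i) (v j) ⟨
    Side i ! v j          ∎
    where
    open ≡-Reasoning
    edge : Reach (removeAt E i) (u j) (v j)
    edge = step (inj₁ (lookup∈removeAt E j≢i)) here

  gap : Fin (length E) → ℕ
  gap i = ℕ.∣ ∣ Side i ∣ - ∣ ∁ (Side i) ∣ ∣

  center-edge : Fin (length E) → Σ (Fin (length E)) (IsCenterEdge E)
  center-edge e = c , c-center
    where
    c : Fin (length E)
    c = argmin gap e (allFin (length E))
    c-center : IsCenterEdge E c
    c-center _ _ c-sides j _ _ j-sides with Sides-unique c c-sides | Sides-unique j j-sides
    ... | refl , refl | refl , refl = All.lookup (f[argmin]≤f[xs] e (allFin (length E))) (∈-allFin j)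

module CutSums where
  open RationalFacts
  open FiniteSums
  open import Data.Bool using (true; false)
  open import Data.Nat as ℕ using (zero; suc)
  open import Data.Fin.Subset using (∁; ∣_∣)
  open import Data.Fin.Subset.Properties using (∣∁p∣≡n∸∣p∣)
  open import Data.List using ([]; _∷_; lookup)
  open import Data.Product using (_,_; proj₁; proj₂)
  open import Data.Rational as ℚ using (1ℚ; _+_; _*_; _-_)
  import Data.Rational.Properties as ℚₚ
  open import Data.Vec using () renaming (lookup to _!_)
  open import Function using (_∘_)
  open import Relation.Binary.PropositionalEquality

  objective≡∑ : ∀ {n} (E : Graph n) z →
    objective E z ≡ (∑[ i < length E ] ℚ.∣ z (proj₁ (lookup E i)) - z (proj₂ (lookup E i)) ∣)
  objective≡∑ E z = sumℚ-map E (λ e → ℚ.∣ z (proj₁ e) - z (proj₂ e) ∣)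

  fromℕ-cutSize≡objective-𝟙 : ∀ {n} (E : Graph n) S → fromℕ (cutSize E S) ≡ objective E (𝟙 ∘ (S !_))
  fromℕ-cutSize≡objective-𝟙 []            S = refl
  fromℕ-cutSize≡objective-𝟙 ((x , y) ∷ E) S with S ! x | S ! y
  ... | true  | true  = trans (fromℕ-cutSize≡objective-𝟙 E S) (sym (ℚₚ.+-identityˡ _))
  ... | true  | false = cong (1ℚ +_) (fromℕ-cutSize≡objective-𝟙 E S)
  ... | false | true  = cong (1ℚ +_) (fromℕ-cutSize≡objective-𝟙 E S)
  ... | false | false = trans (fromℕ-cutSize≡objective-𝟙 E S) (sym (ℚₚ.+-identityˡ _))

  -- Holds even for S = ∅ and S = V, where density and recip both return 0.
  density≡cut*recip : ∀ {n} (E : Graph n) S → density E S ≡ fromℕ (cutSize E S) * recip (∣ S ∣ ℕ.* ∣ ∁ S ∣)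
  density≡cut*recip {n} E S rewrite ∣∁p∣≡n∸∣p∣ S with ∣ S ∣ ℕ.* (n ℕ.∸ ∣ S ∣)
  ... | zero  = sym (ℚₚ.*-zeroʳ (fromℕ (cutSize E S)))
  ... | suc k = /≡*recip (cutSize E S) k

module CutInequality {n : ℕ} (E : Graph n) (tree : IsTree E) where
  open Reachability using (Reach-invariant)
  open FundamentalCuts E tree
  open RationalFacts
  open FiniteSums
  open CutSums
  open import Data.Bool using (Bool; true; false)
  open import Data.Fin.Subset using (Subset; ∁; ∣_∣)
  open import Data.Product using (proj₁)
  open import Data.Rational as ℚ using (ℚ; 0ℚ; 1ℚ; _+_; _*_; _-_; _≤_)
  import Data.Rational.Properties as ℚₚ
  open import Data.Rational.Solver using (module +-*-Solver)
  open +-*-Solver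
  open import Data.Vec using () renaming (lookup to _!_)
  open import Function using (_∘_)
  open import Relation.Binary.PropositionalEquality

  δ : (Fin n → ℚ) → Fin (length E) → ℚ
  δ z i = z (u i) - z (v i)

  potential : (Fin n → ℚ) → Fin n → ℚ
  potential z w = ∑[ i < length E ] (𝟙 (Side i ! w) * δ z i)

  potential-jump : ∀ z j → potential z (u j) - potential z (v j) ≡ δ z j
  potential-jump z j = begin
    potential z (u j) - potential z (v j)
      ≡⟨ ∑-distrib-minus (λ i → 𝟙 (Side i ! u j) * δ z i) (λ i → 𝟙 (Side i ! v j) * δ z i) ⟨
    (∑[ i < length E ] (𝟙 (Side i ! u j) * δ z i - 𝟙 (Side i ! v j) * δ z i))
      ≡⟨ ∑-only (λ i → 𝟙 (Side i ! u j) * δ z i - 𝟙 (Side i ! v j) * δ z i) j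
                (λ i i≢j → cancel (Side-uncut i j (i≢j ∘ sym))) ⟩
    𝟙 (Side j ! u j) * δ z j - 𝟙 (Side j ! v j) * δ z j
      ≡⟨ cong₂ (λ a b → 𝟙 a * δ z j - 𝟙 b * δ z j) (Side-u j) (Side-v j) ⟩
    1ℚ * δ z j - 0ℚ * δ z j
      ≡⟨ solve 1 (λ d → con 1ℚ :* d :- con 0ℚ :* d := d) refl (δ z j) ⟩
    δ z j
      ∎
    where
    open ≡-Reasoning
    cancel : ∀ {a b x} → a ≡ b → 𝟙 a * x - 𝟙 b * x ≡ 0ℚ
    cancel {a} {x = x} refl = ℚₚ.+-inverseʳ (𝟙 a * x)

  potential-offset-constant : ∀ z x y → potential z x - z x ≡ potential z y - z y
  potential-offset-constant z x y = Reach-invariant (λ w → potential z w - z w) across (proj₁ tree x y)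
    where
    open ≡-Reasoning
    across : ∀ j → potential z (u j) - z (u j) ≡ potential z (v j) - z (v j)
    across j = begin
      gᵤ - z (u j)
        ≡⟨ solve 3 (λ a b c → a :- c := (a :- b) :+ b :- c) refl gᵤ gᵥ (z (u j)) ⟩
      (gᵤ - gᵥ) + gᵥ - z (u j)
        ≡⟨ cong (λ t → t + gᵥ - z (u j)) (potential-jump z j) ⟩
      (z (u j) - z (v j)) + gᵥ - z (u j)
        ≡⟨ solve 3 (λ a b c → (a :- b) :+ c :- a := c :- b) refl (z (u j)) (z (v j)) gᵥ ⟩
      gᵥ - z (v j)
        ∎
      where
      gᵤ gᵥ : ℚ
      gᵤ = potential z (u j)
      gᵥ = potential z (v j)

  summation-by-parts : ∀ z (d : Fin n → ℚ) → sum d ≡ 0ℚ →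
    (∑[ i < length E ] ((∑[ w < n ] (d w * 𝟙 (Side i ! w))) * δ z i)) ≡ (∑[ w < n ] (d w * z w))
  summation-by-parts z d ∑d≡0 = begin
    (∑[ i < length E ] ((∑[ w < n ] (d w * 𝟙 (Side i ! w))) * δ z i))
      ≡⟨ sum-cong-≗ (λ i → trans (*-distribʳ-sum (δ z i) (λ w → d w * 𝟙 (Side i ! w)))
                                  (sum-cong-≗ (λ w → ℚₚ.*-assoc (d w) (𝟙 (Side i ! w)) (δ z i)))) ⟩
    (∑[ i < length E ] (∑[ w < n ] (d w * (𝟙 (Side i ! w) * δ z i))))
      ≡⟨ ∑-comm (λ i w → d w * (𝟙 (Side i ! w) * δ z i)) ⟩
    (∑[ w < n ] (∑[ i < length E ] (d w * (𝟙 (Side i ! w) * δ z i))))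
      ≡⟨ sum-cong-≗ (λ w → *-distribˡ-sum (d w) (λ i → 𝟙 (Side i ! w) * δ z i)) ⟨
    (∑[ w < n ] (d w * potential z w))
      ≡⟨ sum-cong-≗ (λ w → solve 3 (λ d g x → d :* g := d :* x :+ d :* (g :- x)) refl (d w) (potential z w) (z w)) ⟩
    (∑[ w < n ] (d w * z w + d w * (potential z w - z w)))
      ≡⟨ ∑-distrib-+ (λ w → d w * z w) (λ w → d w * (potential z w - z w)) ⟩
    (∑[ w < n ] (d w * z w)) + (∑[ w < n ] (d w * (potential z w - z w)))
      ≡⟨ cong ((∑[ w < n ] (d w * z w)) +_)
              (∑-*-constant≡0 d (λ w → potential z w - z w) (potential-offset-constant z) ∑d≡0) ⟩
    (∑[ w < n ] (d w * z w)) + 0ℚ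
      ≡⟨ ℚₚ.+-identityʳ _ ⟩
    (∑[ w < n ] (d w * z w))
      ∎
    where open ≡-Reasoning

  objective-∘Side : ∀ i (φ : Bool → ℚ) → objective E (φ ∘ (Side i !_)) ≡ ℚ.∣ φ true - φ false ∣
  objective-∘Side i φ = begin
    objective E (φ ∘ (Side i !_))
      ≡⟨ objective≡∑ E (φ ∘ (Side i !_)) ⟩
    (∑[ j < length E ] ℚ.∣ φ (Side i ! u j) - φ (Side i ! v j) ∣)
      ≡⟨ ∑-only (λ j → ℚ.∣ φ (Side i ! u j) - φ (Side i ! v j) ∣) i
                (λ j j≢i → trans (cong (λ b → ℚ.∣ φ b - φ (Side i ! v j) ∣) (Side-uncut i j j≢i))
                                 (cong ℚ.∣_∣ (ℚₚ.+-inverseʳ (φ (Side i ! v j))))) ⟩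
    ℚ.∣ φ (Side i ! u i) - φ (Side i ! v i) ∣
      ≡⟨ cong₂ (λ a b → ℚ.∣ φ a - φ b ∣) (Side-u i) (Side-v i) ⟩
    ℚ.∣ φ true - φ false ∣
      ∎
    where open ≡-Reasoning

  cut-inequality : ∀ (Π : ℚ) → (∀ i → fromℕ ∣ Side i ∣ * fromℕ ∣ ∁ (Side i) ∣ ≤ Π) →
    ∀ (P : Subset n) z → (∑[ w < n ] (centered P w * z w)) ≤ Π * objective E z
  cut-inequality Π sides≤Π P z = begin
    (∑[ w < n ] (centered P w * z w))        ≡⟨ summation-by-parts z (centered P) (∑-centered P) ⟨
    (∑[ i < length E ] (y i * δ z i))       ≤⟨ ∑-mono-≤ term≤ ⟩
    (∑[ i < length E ] (Π * ℚ.∣ δ z i ∣))   ≡⟨ *-distribˡ-sum Π (λ i → ℚ.∣ δ z i ∣) ⟨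
    Π * (∑[ i < length E ] ℚ.∣ δ z i ∣)     ≡⟨ cong (Π *_) (objective≡∑ E z) ⟨
    Π * objective E z                        ∎
    where
    open ℚₚ.≤-Reasoning
    y : Fin (length E) → ℚ
    y i = ∑[ w < n ] (centered P w * 𝟙 (Side i ! w))
    term≤ : ∀ i → y i * δ z i ≤ Π * ℚ.∣ δ z i ∣
    term≤ i = begin
      y i * δ z i               ≤⟨ p≤∣p∣ (y i * δ z i) ⟩
      ℚ.∣ y i * δ z i ∣         ≡⟨ ℚₚ.∣p*q∣≡∣p∣*∣q∣ (y i) (δ z i) ⟩
      ℚ.∣ y i ∣ * ℚ.∣ δ z i ∣   ≤⟨ ℚₚ.*-monoʳ-≤-nonNeg ℚ.∣ δ z i ∣ {{ℚₚ.∣-∣-nonNeg (δ z i)}} ∣y∣≤Π ⟩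
      Π * ℚ.∣ δ z i ∣           ∎
      where
      ∣y∣≤Π : ℚ.∣ y i ∣ ≤ Π
      ∣y∣≤Π = ℚₚ.≤-trans (∣∑centered*𝟙∣≤∣A∣*∣∁A∣ P (Side i)) (sides≤Π i)

module CenterEdge {n : ℕ} (E : Graph n) (tree : IsTree E) (c : Fin (length E)) (c-center : IsCenterEdge E c) where
  open FundamentalCuts E tree
  open CutInequality E tree
  open SubsetFacts using (∣p∣+∣∁p∣≡n; Nonempty⇒∣p∣≢0)
  open RationalFacts
  open FiniteSums
  open CutSums
  open NatProducts using (more-balanced⇒*-≤)
  open import Data.Bool using (Bool; true; false)
  open import Data.Nat as ℕ using (NonZero)
  import Data.Nat.Properties as ℕₚ
  open import Data.Fin.Subset using (Subset; ∁; ∣_∣; Nonempty)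
  open import Data.Product using (_,_)
  open import Data.Rational as ℚ using (ℚ; 0ℚ; 1ℚ; ½; _+_; _*_; _-_; -_; _≤_; _≤?_)
  import Data.Rational.Properties as ℚₚ
  open import Data.Rational.Solver using (module +-*-Solver)
  open +-*-Solver
  open import Data.Vec using (tabulate) renaming (lookup to _!_)
  open import Data.Vec.Properties using (lookup∘tabulate)
  open import Function using (_∘_)
  open import Relation.Nullary using (Dec; does)
  open import Relation.Binary.PropositionalEquality

  p q : ℕ
  p = ∣ Side c ∣
  q = ∣ ∁ (Side c) ∣

  instance
    p≢0 : NonZero p
    p≢0 = Nonempty⇒∣p∣≢0 (u c , u∈Side c)
    q≢0 : NonZero q
    q≢0 = Nonempty⇒∣p∣≢0 (v c , v∈∁Side c)
    pq≢0 : NonZero (p ℕ.* q)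
    pq≢0 = ℕₚ.m*n≢0 p q

  Π : ℚ
  Π = fromℕ (p ℕ.* q)

  sides≤Π : ∀ j → fromℕ ∣ Side j ∣ * fromℕ ∣ ∁ (Side j) ∣ ≤ Π
  sides≤Π j = subst (_≤ Π) (fromℕ-* ∣ Side j ∣ ∣ ∁ (Side j) ∣)
    (fromℕ-mono-≤ (more-balanced⇒*-≤ {∣ Side j ∣} {∣ ∁ (Side j) ∣} {p} {q}
      (trans (∣p∣+∣∁p∣≡n (Side j)) (sym (∣p∣+∣∁p∣≡n (Side c))))
      (c-center (Side c) (∁ (Side c)) (Side-sides c) j (Side j) (∁ (Side j)) (Side-sides j))))

  center-inequality : ∀ (P : Subset n) z → (∑[ w < n ] (centered P w * z w)) ≤ Π * objective E z
  center-inequality = cut-inequality Π sides≤Π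

  density-Side : density E (Side c) ≡ 1ℚ * recip (p ℕ.* q)
  density-Side = begin
    density E (Side c)
      ≡⟨ density≡cut*recip E (Side c) ⟩
    fromℕ (cutSize E (Side c)) * recip (p ℕ.* q)
      ≡⟨ cong (_* recip (p ℕ.* q)) (fromℕ-cutSize≡objective-𝟙 E (Side c)) ⟩
    objective E (𝟙 ∘ (Side c !_)) * recip (p ℕ.* q)
      ≡⟨ cong (_* recip (p ℕ.* q)) (objective-∘Side c 𝟙) ⟩
    1ℚ * recip (p ℕ.* q)
      ∎
    where open ≡-Reasoning

  Side-sparser : ∀ S → Nonempty S → Nonempty (∁ S) → density E (Side c) ≤ density E S
  Side-sparser S S≢∅ ∁S≢∅ = subst₂ _≤_ (sym density-Side) (sym (density≡cut*recip E S))
    (*-recip-≤ {p ℕ.* q} {∣ S ∣ ℕ.* ∣ ∁ S ∣} {{pq≢0}} {{s∁s≢0}} {1ℚ} {fromℕ (cutSize E S)} (begin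
      1ℚ * fromℕ (∣ S ∣ ℕ.* ∣ ∁ S ∣)            ≡⟨ ℚₚ.*-identityˡ _ ⟩
      fromℕ (∣ S ∣ ℕ.* ∣ ∁ S ∣)                 ≡⟨ ∑-centered*𝟙≡∣P∣*∣∁P∣ S ⟨
      (∑[ w < n ] (centered S w * 𝟙 (S ! w)))   ≤⟨ center-inequality S (𝟙 ∘ (S !_)) ⟩
      Π * objective E (𝟙 ∘ (S !_))             ≡⟨ cong (Π *_) (fromℕ-cutSize≡objective-𝟙 E S) ⟨
      Π * fromℕ (cutSize E S)                  ≡⟨ ℚₚ.*-comm Π _ ⟩
      fromℕ (cutSize E S) * Π                  ∎))
    where
    open ℚₚ.≤-Reasoning
    s∁s≢0 : NonZero (∣ S ∣ ℕ.* ∣ ∁ S ∣)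
    s∁s≢0 = ℕₚ.m*n≢0 ∣ S ∣ ∣ ∁ S ∣ {{Nonempty⇒∣p∣≢0 S≢∅}} {{Nonempty⇒∣p∣≢0 ∁S≢∅}}

  Side-isSparsest : IsSparsestCut E (Side c)
  Side-isSparsest = (u c , u∈Side c) , (v c , v∈∁Side c) , Side-sparser

  β : ℚ
  β = ½ * (recip p + recip q)

  0≤β : 0ℚ ≤ β
  0≤β = subst (0ℚ ≤_) (sym (ℚₚ.*-distribˡ-+ ½ (recip p) (recip q)))
              (ℚₚ.+-mono-≤ (0≤½*recip p) (0≤½*recip q))

  β*Π≡½*n : β * Π ≡ ½ * fromℕ n
  β*Π≡½*n = begin
    β * Π
      ≡⟨ cong (β *_) (fromℕ-* p q) ⟩
    ½ * (recip p + recip q) * (P * Q)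
      ≡⟨ solve 5 (λ h x y P Q → h :* (x :+ y) :* (P :* Q) := Q :* (P :* (h :* x)) :+ P :* (Q :* (h :* y)))
                 refl ½ (recip p) (recip q) P Q ⟩
    Q * (P * (½ * recip p)) + P * (Q * (½ * recip q))
      ≡⟨ cong₂ (λ s t → Q * s + P * t) (fromℕ*[½*recip]≡½ p) (fromℕ*[½*recip]≡½ q) ⟩
    Q * ½ + P * ½
      ≡⟨ solve 3 (λ h P Q → Q :* h :+ P :* h := h :* (P :+ Q)) refl ½ P Q ⟩
    ½ * (P + Q)
      ≡⟨ cong (½ *_) (fromℕ[n]≡∣p∣+∣∁p∣ (Side c)) ⟨
    ½ * fromℕ n
      ∎
    where
    open ≡-Reasoning
    P Q : ℚ
    P = fromℕ p
    Q = fromℕ q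

  β-lower : ∀ z → Feasible z → β ≤ objective E z
  β-lower z (∑z≡0 , ∑∣z∣≡1) = ℚₚ.*-cancelʳ-≤-pos Π {{fromℕ-pos (p ℕ.* q)}} (begin
    β * Π
      ≡⟨ β*Π≡½*n ⟩
    ½ * fromℕ n
      ≡⟨ solve 3 (λ h N π → h :* N := N :* h :- π :* con 0ℚ) refl ½ (fromℕ n) (fromℕ ∣ P ∣) ⟩
    fromℕ n * ½ - fromℕ ∣ P ∣ * 0ℚ
      ≡⟨ cong₂ (λ s t → fromℕ n * s - fromℕ ∣ P ∣ * t) positive-part≡½ sum≡0 ⟨
    fromℕ n * (∑[ w < n ] (𝟙 (P ! w) * z w)) - fromℕ ∣ P ∣ * sum z
      ≡⟨ ∑-centered*z P z ⟨
    (∑[ w < n ] (centered P w * z w))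
      ≤⟨ center-inequality P z ⟩
    Π * objective E z
      ≡⟨ ℚₚ.*-comm Π (objective E z) ⟩
    objective E z * Π
      ∎)
    where
    open ℚₚ.≤-Reasoning
    0≤z? : ∀ w → Dec (0ℚ ≤ z w)
    0≤z? w = 0ℚ ≤? z w
    P : Subset n
    P = tabulate (does ∘ 0≤z?)
    sum≡0 : sum z ≡ 0ℚ
    sum≡0 = trans (sym (sumℚ-allFin z)) ∑z≡0
    positive-part≡½ : (∑[ w < n ] (𝟙 (P ! w) * z w)) ≡ ½
    positive-part≡½ = trans (sum-cong-≗ (λ w → cong (λ b → 𝟙 b * z w) (lookup∘tabulate (does ∘ 0≤z?) w)))
      (∑-𝟙[0≤z]*z≡½ z 0≤z? sum≡0 (trans (sym (sumℚ-allFin (λ w → ℚ.∣ z w ∣))) ∑∣z∣≡1))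

  extremal : Bool → ℚ
  extremal true  = ½ * recip p
  extremal false = - (½ * recip q)

  z⋆ : Fin n → ℚ
  z⋆ = extremal ∘ (Side c !_)

  z⋆-feasible : Feasible z⋆
  z⋆-feasible =
    trans (sumℚ-allFin z⋆) (trans (∑-∘lookup extremal (Side c)) sum≡0) ,
    trans (sumℚ-allFin (ℚ.∣_∣ ∘ z⋆)) (trans (∑-∘lookup (ℚ.∣_∣ ∘ extremal) (Side c)) ∣sum∣≡1)
    where
    open ≡-Reasoning
    sum≡0 : fromℕ p * (½ * recip p) + fromℕ q * (- (½ * recip q)) ≡ 0ℚ
    sum≡0 = begin
      fromℕ p * (½ * recip p) + fromℕ q * (- (½ * recip q))
        ≡⟨ cong (fromℕ p * (½ * recip p) +_) (ℚₚ.neg-distribʳ-* (fromℕ q) (½ * recip q)) ⟨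
      fromℕ p * (½ * recip p) - fromℕ q * (½ * recip q)
        ≡⟨ cong₂ _-_ (fromℕ*[½*recip]≡½ p) (fromℕ*[½*recip]≡½ q) ⟩
      ½ - ½
        ≡⟨ ℚₚ.+-inverseʳ ½ ⟩
      0ℚ
        ∎
    ∣sum∣≡1 : fromℕ p * ℚ.∣ ½ * recip p ∣ + fromℕ q * ℚ.∣ - (½ * recip q) ∣ ≡ 1ℚ
    ∣sum∣≡1 = begin
      fromℕ p * ℚ.∣ ½ * recip p ∣ + fromℕ q * ℚ.∣ - (½ * recip q) ∣
        ≡⟨ cong₂ (λ s t → fromℕ p * s + fromℕ q * t) (ℚₚ.0≤p⇒∣p∣≡p (0≤½*recip p))
                 (trans (ℚₚ.∣-p∣≡∣p∣ (½ * recip q)) (ℚₚ.0≤p⇒∣p∣≡p (0≤½*recip q))) ⟩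
      fromℕ p * (½ * recip p) + fromℕ q * (½ * recip q)
        ≡⟨ cong₂ _+_ (fromℕ*[½*recip]≡½ p) (fromℕ*[½*recip]≡½ q) ⟩
      ½ + ½
        ≡⟨⟩
      1ℚ
        ∎

  z⋆-objective : objective E z⋆ ≡ β
  z⋆-objective = begin
    objective E z⋆
      ≡⟨ objective-∘Side c extremal ⟩
    ℚ.∣ ½ * recip p - - (½ * recip q) ∣
      ≡⟨ cong ℚ.∣_∣ (solve 3 (λ h x y → h :* x :- (:- (h :* y)) := h :* (x :+ y)) refl ½ (recip p) (recip q)) ⟩
    ℚ.∣ β ∣
      ≡⟨ ℚₚ.0≤p⇒∣p∣≡p 0≤β ⟩
    β
      ∎
    where open ≡-Reasoning

  β-isBValue : IsBValue E β
  β-isBValue = (z⋆ , z⋆-feasible , z⋆-objective) , β-lower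

open import Data.Nat using (ℕ; _≤_; s≤s)
open import Data.Fin using (Fin; zero; suc)
open import Data.Fin.Subset using (Subset; ∣_∣; ∁)
open import Data.List using (length; _∷_; [])
open import Data.Product using (_×_; Σ; _,_; proj₁; proj₂)
open import Data.Rational using (½; _*_; _+_)

theorem5p1 : ∀ {n : ℕ} (E : Graph n) → 2 ≤ n → IsTree E →
  Σ (Fin (length E)) (λ i → Σ (Subset n) (λ Su → Σ (Subset n) (λ Sv →
    Sides E i Su Sv × IsCenterEdge E i × IsSparsestCut E Su ×
    IsBValue E (½ * (recip ∣ Su ∣ + recip ∣ Sv ∣)))))
theorem5p1 [] (s≤s (s≤s _)) tree with Reachability.Reach-[] (proj₁ tree zero (suc zero))
... | ()
theorem5p1 E@(_ ∷ _) _ tree = c , Side c , ∁ (Side c) , Side-sides c , c-center , Side-isSparsest , β-isBValue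
  where
  open FundamentalCuts E tree
  c : Fin (length E)
  c = proj₁ (center-edge zero)
  c-center : IsCenterEdge E c
  c-center = proj₂ (center-edge zero)
  open CenterEdge E tree c c-center
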